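{- Let $q$ be a prime with $q\equiv 3\pmod 4$, $m\ge 3$ an integer, and $n=q^m$. Then the line graph $L(\overline{\Gamma(\mathbb{Z}_n[i])})$ of the complement of the zero-divisor graph of $\mathbb{Z}_n[i]$ is pancyclic.
   Context: $\mathbb{Z}_n[i]=\mathbb{Z}[i]/\langle n\rangle=\{a+bi : a,b\in\mathbb{Z}_n\}$ with $i^2=-1$. For a finite commutative ring $R$ with unity, $\Gamma(R)$ has vertex set the nonzero zero-divisors of $R$, distinct $x,y$ adjacent iff $xy=0$. $\overline{G}$ is the complement graph of $G$. The line graph $L(G)$ has the edges of $G$ as vertices, two being adjacent iff they share an endpoint in $G$. A graph of order $N$ is pancyclic if $N\ge 3$ and it contains a cycle of length $k$ for every $3\le k\le N$. -}

module Defs where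

open import Data.Nat using (ℕ; zero; suc; _+_; _*_; _∸_; _<_; _≤_; NonZero)
open import Data.Nat.Properties using (_<?_)
open import Data.Nat.DivMod using (_mod_)
open import Data.Fin using (Fin; toℕ)
open import Data.Fin.Properties using (any?) renaming (_≟_ to _≟F_)
open import Data.Product using (Σ; ∃; _×_; _,_; proj₁; proj₂)
open import Data.Product.Properties using (≡-dec)
open import Data.Product.Relation.Binary.Pointwise.NonDependent using ()
open import Data.Sum using (_⊎_)
open import Data.List using (List; length; filter; cartesianProduct; allFin; lookup)
open import Relation.Nullary using (¬_; Dec; yes; no)
open import Relation.Nullary.Decidable using (_×-dec_; ¬?; map′)
open import Relation.Binary.PropositionalEquality using (_≡_; _≢_)
open import Function.Definitions using (Injective)

-- The ring ℤ_n[i] = { a + b i : a, b ∈ ℤ_n },  i² = -1.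
-- An element a + b i is represented by the pair (a , b) of residues.

ZnI : ℕ → Set
ZnI n = Fin n × Fin n

module _ (n : ℕ) .{{_ : NonZero n}} where

  0# : ZnI n
  0# = (0 mod n , 0 mod n)

  -- (a + b i)(c + d i) = (ac - bd) + (ad + bc) i ;  -1 ≡ n - 1 (mod n)
  _·_ : ZnI n → ZnI n → ZnI n
  (a , b) · (c , d) =
    ( (toℕ a * toℕ c + (n ∸ 1) * (toℕ b * toℕ d)) mod n
    , (toℕ a * toℕ d + toℕ b * toℕ c) mod n )

  _≟Z_ : (x y : ZnI n) → Dec (x ≡ y)
  _≟Z_ = ≡-dec _≟F_ _≟F_

  IsVertexΓ : ZnI n → Set
  IsVertexΓ x = x ≢ 0# × ∃ λ (y : ZnI n) → y ≢ 0# × x · y ≡ 0#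

  isVertexΓ? : (x : ZnI n) → Dec (IsVertexΓ x)
  isVertexΓ? x = ¬? (x ≟Z 0#) ×-dec
    map′ (λ { (a , b , p) → (a , b) , p }) (λ { ((a , b) , p) → a , b , p })
      (any? λ a → any? λ b → ¬? ((a , b) ≟Z 0#) ×-dec ((x · (a , b)) ≟Z 0#))

  AdjΓ : ZnI n → ZnI n → Set
  AdjΓ x y = IsVertexΓ x × IsVertexΓ y × x ≢ y × x · y ≡ 0#

  AdjΓc : ZnI n → ZnI n → Set
  AdjΓc x y = IsVertexΓ x × IsVertexΓ y × x ≢ y × ¬ AdjΓ x y

  -- a fixed total order on ℤ_n[i] (via an injective code), used to list each
  -- unordered edge {x , y} exactly once as the pair (x , y) with x ≺ y
  code : ZnI n → ℕ
  code (a , b) = toℕ a * n + toℕ b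

  IsEdgeΓc : ZnI n × ZnI n → Set
  IsEdgeΓc (x , y) = code x < code y × AdjΓc x y

  isEdgeΓc? : (e : ZnI n × ZnI n) → Dec (IsEdgeΓc e)
  isEdgeΓc? (x , y) = (code x <? code y) ×-dec
    (isVertexΓ? x ×-dec isVertexΓ? y ×-dec ¬? (x ≟Z y) ×-dec ¬? adjΓ?)
    where
    adjΓ? : Dec (AdjΓ x y)
    adjΓ? = isVertexΓ? x ×-dec isVertexΓ? y ×-dec ¬? (x ≟Z y) ×-dec ((x · y) ≟Z 0#)

  elements : List (ZnI n)
  elements = cartesianProduct (allFin n) (allFin n)

  edgesΓc : List (ZnI n × ZnI n)
  edgesΓc = filter isEdgeΓc? (cartesianProduct elements elements)

module _ {A : Set} where

  AdjLine : A × A → A × A → Set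
  AdjLine e f = e ≢ f ×
    ( proj₁ e ≡ proj₁ f ⊎ proj₁ e ≡ proj₂ f ⊎ proj₂ e ≡ proj₁ f ⊎ proj₂ e ≡ proj₂ f )

module _ {B : Set} where

  HasCycle : (vs : List B) (adj : B → B → Set) (k : ℕ) → Set
  HasCycle vs adj k =
    Σ (Fin k → Fin (length vs)) λ f →
      Injective _≡_ _≡_ f ×
      (∀ (i j : Fin k) → (suc (toℕ i) ≡ toℕ j ⊎ (suc (toℕ i) ≡ k × toℕ j ≡ 0)) →
         adj (lookup vs (f i)) (lookup vs (f j)))

  Pancyclic : (vs : List B) (adj : B → B → Set) → Set
  Pancyclic vs adj =
    3 ≤ length vs × (∀ k → 3 ≤ k → k ≤ length vs → HasCycle vs adj k)

LineComplΓPancyclic : (n : ℕ) .{{_ : NonZero n}} → Set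
LineComplΓPancyclic n = Pancyclic (edgesΓc n) AdjLine

module Submission where

-- Because -1 is not a square modulo q, the nonzero zero-divisors of ℤ_n[i]
-- are exactly the nonzero multiples of q.  Take the vertex z = q as a hub:
-- if xy ≠ 0 for zero-divisors x and y, then qx ≠ 0 (otherwise x would kill
-- the multiple y of q), so every endpoint x ≠ z of an edge of the complement
-- graph is adjacent to z.  In any graph with such a hub the edges at z form
-- a clique of the line graph, and every other edge {x , y} can be threaded
-- into a closed walk next to the hub edges {z , x} and {z , y}; hence the
-- line graph has cycles of all lengths from 3 to its order.

open import Defs
open import Data.Nat using (ℕ; _^_; _%_; _≤_)
open import Data.Nat.Properties using (m^n≢0)
open import Data.Nat.Primality using (Prime; prime⇒nonZero)
open import Relation.Binary.PropositionalEquality using (_≡_)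
open import Relation.Binary.Definitions using (DecidableEquality)

-- Fermat's little theorem and primes q ≡ 3 (mod 4) dividing a sum of two
-- squares.  Congruences modulo p are written as equations x ≡ y + p * M
-- with an explicit quotient M.
module NumberTheory where
  open import Data.Nat
  open import Data.Nat.Properties
  open import Data.Nat.Divisibility
  open import Data.Nat.DivMod using (m≡m%n+[m/n]*n)
  open import Data.Nat.Primality using (prime; euclidsLemma)
  open import Data.Nat.Solver using (module +-*-Solver)
  open import Data.Product using (∃; _,_; proj₁; proj₂)
  open import Data.Sum using (inj₁; inj₂)
  open import Data.Empty using (⊥-elim)
  open import Relation.Nullary using (¬_; yes; no)
  open import Relation.Binary.PropositionalEquality
  open +-*-Solver

  choose : ℕ → ℕ → ℕ
  choose n       zero    = 1
  choose zero    (suc k) = 0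
  choose (suc n) (suc k) = choose n k + choose n (suc k)

  choose-beyond : ∀ n k → n < k → choose n k ≡ 0
  choose-beyond zero    (suc k) _         = refl
  choose-beyond (suc n) (suc k) (s≤s n<k)
    rewrite choose-beyond n k n<k | choose-beyond n (suc k) (m<n⇒m<1+n n<k) = refl

  choose-diag : ∀ n → choose n n ≡ 1
  choose-diag zero = refl
  choose-diag (suc n) rewrite choose-diag n | choose-beyond n (suc n) (n<1+n n) = refl

  choose-absorb : ∀ n k → suc k * choose (suc n) (suc k) ≡ suc n * choose n k
  choose-absorb zero    zero    = refl
  choose-absorb zero    (suc k) = *-zeroʳ (suc (suc k))
  choose-absorb (suc n) zero    =
    cong suc (trans (+-identityʳ _) (trans (sym (*-identityˡ _)) (choose-absorb n zero)))
  choose-absorb (suc n) (suc k) = begin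
    suc (suc k) * (C₁ + C₂)
      ≡⟨ solve 3 (λ k c₁ c₂ → (con 2 :+ k) :* (c₁ :+ c₂) := ((con 1 :+ k) :* c₁ :+ c₁) :+ (con 2 :+ k) :* c₂)
           refl k C₁ C₂ ⟩
    (suc k * C₁ + C₁) + suc (suc k) * C₂
      ≡⟨ cong₂ (λ u v → (u + C₁) + v) (choose-absorb n k) (choose-absorb n (suc k)) ⟩
    (suc n * choose n k + C₁) + suc n * choose n (suc k)
      ≡⟨ solve 4 (λ n a c₁ b → (n :* a :+ c₁) :+ n :* b := c₁ :+ n :* (a :+ b))
           refl (suc n) (choose n k) C₁ (choose n (suc k)) ⟩
    suc (suc n) * C₁ ∎
    where
    open ≡-Reasoning
    C₁ = choose (suc n) (suc k)
    C₂ = choose (suc n) (suc (suc k))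

  prime>1 : ∀ {p} → Prime p → 1 < p
  prime>1 {p} (prime {{nt}} _) = nonTrivial⇒n>1 p

  -- p divides C(p,k) for 0 < k < p, since k·C(p,k) = p·C(p-1,k-1).
  prime∣choose : ∀ {p} → Prime p → ∀ k → 0 < k → k < p → p ∣ choose p k
  prime∣choose {suc n} pr (suc k) _ k<p
    with euclidsLemma (suc k) (choose (suc n) (suc k)) pr
           (divides (choose n k) (trans (choose-absorb n k) (*-comm (suc n) _)))
  ... | inj₂ p∣C = p∣C
  ... | inj₁ p∣k = ⊥-elim (<⇒≱ k<p (∣⇒≤ p∣k))

  binomialSum : ℕ → ℕ → ℕ → ℕ
  binomialSum n a zero    = 1
  binomialSum n a (suc j) = binomialSum n a j + choose n (suc j) * a ^ suc j

  binomialSum-step : ∀ n a j →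
    binomialSum (suc n) a (suc j) ≡ binomialSum n a (suc j) + a * binomialSum n a j
  binomialSum-step n a zero =
    solve 2 (λ a c → con 1 :+ (con 1 :+ c) :* (a :* con 1) := (con 1 :+ c :* (a :* con 1)) :+ a :* con 1)
      refl a (choose n 1)
  binomialSum-step n a (suc j) = begin
    binomialSum (suc n) a (suc j) + (C₁ + C₂) * (a * a ^ suc j)
      ≡⟨ cong (_+ (C₁ + C₂) * (a * a ^ suc j)) (binomialSum-step n a j) ⟩
    S₁ + a * S₀ + (C₁ + C₂) * (a * a ^ suc j)
      ≡⟨ solve 6 (λ s₁ s₀ a c₁ c₂ x → s₁ :+ a :* s₀ :+ (c₁ :+ c₂) :* (a :* x)
                                      := (s₁ :+ c₂ :* (a :* x)) :+ a :* (s₀ :+ c₁ :* x))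
           refl S₁ S₀ a C₁ C₂ (a ^ suc j) ⟩
    binomialSum n a (suc (suc j)) + a * S₁ ∎
    where
    open ≡-Reasoning
    S₀ = binomialSum n a j
    S₁ = binomialSum n a (suc j)
    C₁ = choose n (suc j)
    C₂ = choose n (suc (suc j))

  binomial-theorem : ∀ n a → suc a ^ n ≡ binomialSum n a n
  binomial-theorem zero    a = refl
  binomial-theorem (suc n) a = begin
    suc a * suc a ^ n                     ≡⟨ cong (suc a *_) (binomial-theorem n a) ⟩
    binomialSum n a n + a * binomialSum n a n ≡⟨ cong (_+ a * binomialSum n a n) (sym stable) ⟩
    binomialSum n a (suc n) + a * binomialSum n a n ≡⟨ sym (binomialSum-step n a n) ⟩
    binomialSum (suc n) a (suc n)         ∎
    where
    open ≡-Reasoning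
    stable : binomialSum n a (suc n) ≡ binomialSum n a n
    stable rewrite choose-beyond n (suc n) (n<1+n n) = +-identityʳ _

  binomialSum-prime : ∀ {p} → Prime p → ∀ a j → j < p → ∃ λ M → binomialSum p a j ≡ 1 + p * M
  binomialSum-prime {p} pr a zero    _ = 0 , cong suc (sym (*-zeroʳ p))
  binomialSum-prime {p} pr a (suc j) j<p
    with binomialSum-prime pr a j (<-trans (n<1+n j) j<p) | prime∣choose pr (suc j) z<s j<p
  ... | M , eq | divides c eqC = M + c * a ^ suc j , (begin
    binomialSum p a j + choose p (suc j) * a ^ suc j ≡⟨ cong₂ (λ u v → u + v * a ^ suc j) eq eqC ⟩
    1 + p * M + c * p * a ^ suc j
      ≡⟨ solve 4 (λ p m c x → con 1 :+ p :* m :+ c :* p :* x := con 1 :+ p :* (m :+ c :* x)) refl p M c (a ^ suc j) ⟩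
    1 + p * (M + c * a ^ suc j) ∎)
    where open ≡-Reasoning

  freshman : ∀ {p} → Prime p → ∀ a → ∃ λ M → suc a ^ p ≡ suc (a ^ p) + p * M
  freshman {suc r} pr a with binomialSum-prime pr a r ≤-refl
  ... | M , eq = M , (begin
    suc a ^ suc r                                         ≡⟨ binomial-theorem (suc r) a ⟩
    binomialSum (suc r) a r + choose (suc r) (suc r) * a ^ suc r
      ≡⟨ cong₂ (λ u v → u + v * a ^ suc r) eq (choose-diag (suc r)) ⟩
    1 + suc r * M + 1 * a ^ suc r
      ≡⟨ solve 3 (λ p m x → con 1 :+ p :* m :+ con 1 :* x := con 1 :+ x :+ p :* m) refl (suc r) M (a ^ suc r) ⟩
    suc (a ^ suc r) + suc r * M                           ∎)
    where open ≡-Reasoning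

  fermat : ∀ {p} → Prime p → ∀ a → ∃ λ N → a ^ p ≡ a + p * N
  fermat {suc r} pr zero = 0 , sym (*-zeroʳ (suc r))
  fermat {p} pr (suc a) with fermat pr a | freshman pr a
  ... | N , eqN | M , eqM = N + M , (begin
    suc a ^ p                ≡⟨ eqM ⟩
    suc (a ^ p) + p * M      ≡⟨ cong (λ u → suc u + p * M) eqN ⟩
    suc (a + p * N) + p * M  ≡⟨ solve 4 (λ a p n m → con 1 :+ (a :+ p :* n) :+ p :* m := con 1 :+ a :+ p :* (n :+ m)) refl a p N M ⟩
    suc a + p * (N + M)      ∎)
    where open ≡-Reasoning

  -- For c prime to p:  c^(p-1) ≡ 1 (mod p), cancelling c in Fermat's theorem.
  fermat-unit : ∀ {p} → Prime p → ∀ c → ¬ p ∣ c → ∃ λ A → c ^ (p ∸ 1) ≡ 1 + p * A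
  fermat-unit {suc r} pr c p∤c = quotient p∣u-1 , (begin
    c ^ r             ≡⟨ sym (m∸n+n≡m u≥1) ⟩
    (u ∸ 1) + 1       ≡⟨ +-comm (u ∸ 1) 1 ⟩
    1 + (u ∸ 1)       ≡⟨ cong suc (_∣_.equality p∣u-1) ⟩
    1 + quotient p∣u-1 * suc r ≡⟨ cong suc (*-comm (quotient p∣u-1) (suc r)) ⟩
    1 + suc r * quotient p∣u-1 ∎)
    where
    open ≡-Reasoning
    p = suc r
    u = c ^ r
    N = proj₁ (fermat pr c)
    u≥1 : 1 ≤ u
    u≥1 = m^n>0 c {{≢-nonZero (λ { refl → p∤c (p ∣0) })}} r
    c[u-1]≡pN : c * (u ∸ 1) ≡ p * N
    c[u-1]≡pN = begin
      c * (u ∸ 1)     ≡⟨ *-distribˡ-∸ c u 1 ⟩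
      c * u ∸ c * 1   ≡⟨ cong₂ _∸_ (proj₂ (fermat pr c)) (*-identityʳ c) ⟩
      c + p * N ∸ c   ≡⟨ m+n∸m≡n c (p * N) ⟩
      p * N           ∎
    p∣u-1 : p ∣ u ∸ 1
    p∣u-1 with euclidsLemma c (u ∸ 1) pr (divides N (trans c[u-1]≡pN (*-comm p N)))
    ... | inj₁ p∣c   = ⊥-elim (p∤c p∣c)
    ... | inj₂ p∣u-1 = p∣u-1

  sum∣oddPowerSum : ∀ {d} x y → d ∣ x + y → ∀ i → d ∣ x ^ suc (i + i) + y ^ suc (i + i)
  sum∣oddPowerSum {d} x y d∣x+y zero =
    subst (d ∣_) (cong₂ _+_ (sym (*-identityʳ x)) (sym (*-identityʳ y))) d∣x+y
  sum∣oddPowerSum {d} x y d∣x+y (suc i) rewrite +-suc i i =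
    ∣m+n∣m⇒∣n (subst (d ∣_) (+-comm next lower) whole) (∣n⇒∣m*n (x * y) (sum∣oddPowerSum x y d∣x+y i))
    where
    k = suc (i + i)
    next  = x ^ (2 + k) + y ^ (2 + k)
    lower = x * y * (x ^ k + y ^ k)
    -- x^(k+2) + y^(k+2) + xy(x^k + y^k) = (x + y)(x^(k+1) + y^(k+1))
    whole : d ∣ next + lower
    whole = subst (d ∣_)
      (solve 4 (λ x y a b → (x :+ y) :* (x :* a :+ y :* b) := (x :* (x :* a) :+ y :* (y :* b)) :+ x :* y :* (a :+ b))
         refl x y (x ^ k) (y ^ k))
      (∣m⇒∣m*n _ d∣x+y)

  square^ : ∀ c k → (c * c) ^ k ≡ c ^ (k + k)
  square^ c zero = refl
  square^ c (suc k) rewrite square^ c k | +-suc k k =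
    solve 2 (λ c x → (c :* c) :* x := c :* (c :* x)) refl c (c ^ (k + k))

  -- -1 is not a square modulo a prime q ≡ 3 (mod 4): q ∣ c² + d² forces q ∣ c.
  -- Otherwise q ∤ d as well, and with q - 1 = 2k, k odd, Fermat gives
  -- (c²)^k + (d²)^k ≡ 2, while c² + d² divides it; so q ∣ 2, impossible.
  prime≡3∣sumOfSquares : ∀ {q} → Prime q → q % 4 ≡ 3 → ∀ c d → q ∣ c * c + d * d → q ∣ c
  prime≡3∣sumOfSquares {q} pr q≡3 c d q∣sum with q ∣? c
  ... | yes q∣c = q∣c
  ... | no  q∤c = ⊥-elim (<⇒≱ q>2 (∣⇒≤ q∣2))
    where
    q∤d : ¬ q ∣ d
    q∤d q∣d with euclidsLemma c c pr (∣m+n∣m⇒∣n (subst (q ∣_) (+-comm (c * c) (d * d)) q∣sum) (∣m⇒∣m*n d q∣d))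
    ... | inj₁ q∣c = q∤c q∣c
    ... | inj₂ q∣c = q∤c q∣c
    j = q / 4
    q≡3+4j : q ≡ 3 + j * 4
    q≡3+4j = trans (m≡m%n+[m/n]*n q 4) (cong (_+ j * 4) q≡3)
    q>2 : 2 < q
    q>2 = subst (2 <_) (sym q≡3+4j) (s≤s (s≤s (s≤s z≤n)))
    k = suc (j + j)
    k+k≡q-1 : k + k ≡ q ∸ 1
    k+k≡q-1 = trans (solve 1 (λ j → (con 1 :+ (j :+ j)) :+ (con 1 :+ (j :+ j)) := con 2 :+ j :* con 4) refl j)
                    (sym (cong (_∸ 1) q≡3+4j))
    unitSquare : ∀ x → ¬ q ∣ x → ∃ λ A → (x * x) ^ k ≡ 1 + q * A
    unitSquare x q∤x = proj₁ (fermat-unit pr x q∤x) ,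
      trans (square^ x k) (trans (cong (x ^_) k+k≡q-1) (proj₂ (fermat-unit pr x q∤x)))
    A = proj₁ (unitSquare c q∤c)
    B = proj₁ (unitSquare d q∤d)
    q∣2+q[A+B] : q ∣ 2 + q * (A + B)
    q∣2+q[A+B] = subst (q ∣_)
      (trans (cong₂ _+_ (proj₂ (unitSquare c q∤c)) (proj₂ (unitSquare d q∤d)))
             (solve 3 (λ q a b → (con 1 :+ q :* a) :+ (con 1 :+ q :* b) := con 2 :+ q :* (a :+ b)) refl q A B))
      (sum∣oddPowerSum (c * c) (d * d) q∣sum j)
    q∣2 : q ∣ 2
    q∣2 = ∣m+n∣m⇒∣n (subst (q ∣_) (+-comm 2 (q * (A + B))) q∣2+q[A+B]) (m∣m*n (A + B))

  prime^∣-cancel : ∀ {q} → Prime q → ∀ k s c → ¬ q ∣ s → q ^ k ∣ s * c → q ^ k ∣ c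
  prime^∣-cancel pr zero    s c _   _ = 1∣ c
  prime^∣-cancel {q} pr (suc k) s c q∤s q^k+1∣sc
    with euclidsLemma s c pr (∣-trans (m∣m*n (q ^ k)) q^k+1∣sc)
  ... | inj₁ q∣s = ⊥-elim (q∤s q∣s)
  ... | inj₂ (divides c' refl) =
    subst (_∣ c' * q) (*-comm (q ^ k) q) (*-monoˡ-∣ q (prime^∣-cancel pr k s c' q∤s q^k∣sc'))
    where
    q^k∣sc' : q ^ k ∣ s * c'
    q^k∣sc' = *-cancelˡ-∣ q {{prime⇒nonZero pr}}
      (subst (q * q ^ k ∣_) (solve 3 (λ s c q → s :* (c :* q) := q :* (s :* c)) refl s c' q) q^k+1∣sc)

-- A graph on V is given by a
-- duplicate-free list of edges (ordered pairs); z is a fixed vertex, the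
-- hub.  Hub edges (those containing z) pairwise share the endpoint z, so
-- they form a clique in the line graph.  If every endpoint x of a non-hub
-- edge also spans a hub edge {z , x}, every non-hub edge can be threaded
-- into a closed walk of the line graph next to the hub edges at its ends.
module LineGraphWithHub {V : Set} (_≟_ : DecidableEquality V) (z : V) where
  open import Data.Nat using (suc; _+_; _∸_; _<_; s≤s; z≤n; _≤?_)
  open import Function using (case_of_)
  import Data.Nat.Properties as ℕ
  open import Data.Fin using (Fin; zero; suc; toℕ)
  open import Data.Product using (Σ; ∃; _×_; _,_; proj₁; proj₂)
  open import Data.Sum using (_⊎_; inj₁; inj₂)
  open import Data.Empty using (⊥-elim)
  open import Data.Unit using (⊤; tt)
  open import Data.List using (List; []; _∷_; _++_; length; filter; take; lookup)
  open import Data.List.Properties using (++-assoc; length-take; length-++)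
  open import Data.List.Relation.Unary.All using (All; []; _∷_)
  import Data.List.Relation.Unary.All as All
  open import Data.List.Relation.Unary.All.Properties using () renaming (++⁺ to All-++⁺)
  open import Data.List.Relation.Unary.Any using (here; there; index)
  open import Data.List.Relation.Unary.Any.Properties using (lookup-index)
  open import Data.List.Relation.Unary.Unique.Propositional using (Unique; _∷_)
  import Data.List.Relation.Unary.Unique.Propositional.Properties as Unique
  open import Data.List.Membership.Propositional using (_∈_)
  open import Data.List.Membership.Propositional.Properties
    using (∈-++⁻; ∈-++⁺ʳ; ∈-lookup; ∈-filter⁺; ∈-filter⁻)
  open import Data.List.Relation.Binary.Permutation.Propositional
    using (_↭_; refl; prep; swap; trans; ↭-sym; ↭⇒↭ₛ)
  open import Data.List.Relation.Binary.Permutation.Propositional.Properties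
    using (∈-resp-↭; shift; shifts; ++⁺ˡ; ++⁺ʳ; ↭-length)
  import Data.List.Relation.Binary.Permutation.Setoid.Properties as SetoidPerm
  open import Relation.Nullary using (¬_; Dec; yes; no)
  open import Relation.Nullary.Decidable using (_⊎-dec_; ¬?)
  open import Relation.Binary.PropositionalEquality
    using (_≡_; _≢_; refl; sym; cong; subst; subst₂; setoid) renaming (trans to ≡-trans)

  Edge : Set
  Edge = V × V

  _∈ₑ_ : V → Edge → Set
  v ∈ₑ e = proj₁ e ≡ v ⊎ proj₂ e ≡ v

  ShareEnd : Edge → Edge → Set
  ShareEnd e f = proj₁ e ≡ proj₁ f ⊎ proj₁ e ≡ proj₂ f ⊎ proj₂ e ≡ proj₁ f ⊎ proj₂ e ≡ proj₂ f

  AtHub : Edge → Set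
  AtHub e = z ∈ₑ e

  atHub? : (e : Edge) → Dec (AtHub e)
  atHub? e = (proj₁ e ≟ z) ⊎-dec (proj₂ e ≟ z)

  shareEnd-via : ∀ {v e f} → v ∈ₑ e → v ∈ₑ f → ShareEnd e f
  shareEnd-via (inj₁ a) (inj₁ b) = inj₁ (≡-trans a (sym b))
  shareEnd-via (inj₁ a) (inj₂ b) = inj₂ (inj₁ (≡-trans a (sym b)))
  shareEnd-via (inj₂ a) (inj₁ b) = inj₂ (inj₂ (inj₁ (≡-trans a (sym b))))
  shareEnd-via (inj₂ a) (inj₂ b) = inj₂ (inj₂ (inj₂ (≡-trans a (sym b))))

  commonEnd : ∀ {e f} → ShareEnd e f → ∃ λ v → v ∈ₑ e × v ∈ₑ f
  commonEnd {e} (inj₁ eq)                 = proj₁ e , inj₁ refl , inj₁ (sym eq)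
  commonEnd {e} (inj₂ (inj₁ eq))          = proj₁ e , inj₁ refl , inj₂ (sym eq)
  commonEnd {e} (inj₂ (inj₂ (inj₁ eq)))   = proj₂ e , inj₂ refl , inj₁ (sym eq)
  commonEnd {e} (inj₂ (inj₂ (inj₂ eq)))   = proj₂ e , inj₂ refl , inj₂ (sym eq)

  shareEnd-sym : ∀ {e f} → ShareEnd e f → ShareEnd f e
  shareEnd-sym p = let (_ , v∈e , v∈f) = commonEnd p in shareEnd-via v∈f v∈e

  -- Hub walks: edge sequences in which consecutive edges share an
  -- endpoint, starting and ending with hub edges.  Read cyclically they
  -- are closed walks of the line graph, and they concatenate freely.

  data Walk : List Edge → Set where
    []  : Walk []
    [_] : ∀ e → Walk (e ∷ [])
    _∷_ : ∀ {e f es} → ShareEnd e f → Walk (f ∷ es) → Walk (e ∷ f ∷ es)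

  StartsAtHub : List Edge → Set
  StartsAtHub []      = ⊤
  StartsAtHub (e ∷ _) = AtHub e

  EndsAtHub : List Edge → Set
  EndsAtHub []           = ⊤
  EndsAtHub (e ∷ [])     = AtHub e
  EndsAtHub (_ ∷ f ∷ es) = EndsAtHub (f ∷ es)

  HubWalk : List Edge → Set
  HubWalk es = Walk es × StartsAtHub es × EndsAtHub es

  walk-++ : ∀ xs {ys} → Walk xs → Walk ys → EndsAtHub xs → StartsAtHub ys → Walk (xs ++ ys)
  walk-++ []           _        wy _  _  = wy
  walk-++ (e ∷ [])     {[]}     _  _  _  _  = [ e ]
  walk-++ (e ∷ [])     {f ∷ ys} _  wy ex sy = shareEnd-via ex sy ∷ wy
  walk-++ (e ∷ f ∷ xs) (p ∷ wx) wy ex sy    = p ∷ walk-++ (f ∷ xs) wx wy ex sy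

  endsAtHub-++ : ∀ xs {ys} → EndsAtHub xs → EndsAtHub ys → EndsAtHub (xs ++ ys)
  endsAtHub-++ []           _       ey = ey
  endsAtHub-++ (e ∷ [])     {[]}    ex _  = ex
  endsAtHub-++ (e ∷ [])     {_ ∷ _} _  ey = ey
  endsAtHub-++ (e ∷ f ∷ xs) ex      ey = endsAtHub-++ (f ∷ xs) ex ey

  startsAtHub-++ : ∀ xs {ys} → StartsAtHub xs → StartsAtHub ys → StartsAtHub (xs ++ ys)
  startsAtHub-++ []      _  sy = sy
  startsAtHub-++ (_ ∷ _) sx _  = sx

  hubWalk-++ : ∀ xs {ys} → HubWalk xs → HubWalk ys → HubWalk (xs ++ ys)
  hubWalk-++ xs (wx , sx , ex) (wy , sy , ey) =
    walk-++ xs wx wy ex sy , startsAtHub-++ xs sx sy , endsAtHub-++ xs ex ey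

  endsAtHub-snoc : ∀ xs {b} → AtHub b → EndsAtHub (xs ++ b ∷ [])
  endsAtHub-snoc []           hb = hb
  endsAtHub-snoc (_ ∷ [])     hb = hb
  endsAtHub-snoc (_ ∷ f ∷ xs) hb = endsAtHub-snoc (f ∷ xs) hb

  hubEdges⇒hubWalk : ∀ es → All AtHub es → HubWalk es
  hubEdges⇒hubWalk []           []            = [] , tt , tt
  hubEdges⇒hubWalk (e ∷ [])     (he ∷ [])     = [ e ] , he , he
  hubEdges⇒hubWalk (e ∷ f ∷ es) (he ∷ hf ∷ h) =
    let (w , _ , ee) = hubEdges⇒hubWalk (f ∷ es) (hf ∷ h) in
    shareEnd-via he hf ∷ w , he , ee

  module _ {A : Set} where

    lookup-injective : ∀ {xs : List A} → Unique xs → ∀ i j → lookup xs i ≡ lookup xs j → i ≡ j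
    lookup-injective (_ ∷ _)   zero    zero    _  = refl
    lookup-injective (x∉ ∷ _)  zero    (suc j) eq = ⊥-elim (All.lookup x∉ (∈-lookup j) eq)
    lookup-injective (x∉ ∷ _)  (suc i) zero    eq = ⊥-elim (All.lookup x∉ (∈-lookup i) (sym eq))
    lookup-injective (_ ∷ u)   (suc i) (suc j) eq = cong suc (lookup-injective u i j eq)

    length≥1 : ∀ {xs : List A} {a} → a ∈ xs → 1 ≤ length xs
    length≥1 (here _)  = s≤s z≤n
    length≥1 (there _) = s≤s z≤n

    length≥2 : ∀ {xs : List A} {a b} → a ∈ xs → b ∈ xs → a ≢ b → 2 ≤ length xs
    length≥2 (here refl) (here refl) a≢b = ⊥-elim (a≢b refl)
    length≥2 (here _)    (there b∈)  _   = s≤s (length≥1 b∈)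
    length≥2 (there a∈)  (here _)    _   = s≤s (length≥1 a∈)
    length≥2 (there a∈)  (there b∈)  a≢b = ℕ.m≤n⇒m≤1+n (length≥2 a∈ b∈ a≢b)

    length≥3 : ∀ {xs : List A} {a b c} → a ∈ xs → b ∈ xs → c ∈ xs → a ≢ b → a ≢ c → b ≢ c → 3 ≤ length xs
    length≥3 (here refl) (here refl) _           a≢b _   _   = ⊥-elim (a≢b refl)
    length≥3 (here refl) _           (here refl) _   a≢c _   = ⊥-elim (a≢c refl)
    length≥3 _           (here refl) (here refl) _   _   b≢c = ⊥-elim (b≢c refl)
    length≥3 (here _)    (there b∈)  (there c∈)  _   _   b≢c = s≤s (length≥2 b∈ c∈ b≢c)
    length≥3 (there a∈)  (here _)    (there c∈)  _   a≢c _   = s≤s (length≥2 a∈ c∈ a≢c)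
    length≥3 (there a∈)  (there b∈)  (here _)    a≢b _   _   = s≤s (length≥2 a∈ b∈ a≢b)
    length≥3 (there a∈)  (there b∈)  (there c∈)  a≢b a≢c b≢c = ℕ.m≤n⇒m≤1+n (length≥3 a∈ b∈ c∈ a≢b a≢c b≢c)

  walk-step : ∀ es → Walk es → ∀ (i j : Fin (length es)) → suc (toℕ i) ≡ toℕ j →
              ShareEnd (lookup es i) (lookup es j)
  walk-step (e ∷ [])     [ _ ]   zero    zero          ()
  walk-step (e ∷ f ∷ es) (p ∷ w) zero    (suc zero)    _  = p
  walk-step (e ∷ f ∷ es) (p ∷ w) (suc i) (suc j)       eq = walk-step (f ∷ es) w i j (ℕ.suc-injective eq)

  walk-last : ∀ es → EndsAtHub es → ∀ i → suc (toℕ i) ≡ length es → AtHub (lookup es i)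
  walk-last (e ∷ [])     h zero    _  = h
  walk-last (e ∷ f ∷ es) h (suc i) eq = walk-last (f ∷ es) h i (ℕ.suc-injective eq)

  walk-first : ∀ es → StartsAtHub es → ∀ j → toℕ j ≡ 0 → AtHub (lookup es j)
  walk-first (e ∷ es) h zero _ = h

  hubWalk⇒cycle : ∀ vs es → HubWalk es → Unique es → (∀ {e} → e ∈ es → e ∈ vs) → 3 ≤ length es →
                  HasCycle vs AdjLine (length es)
  hubWalk⇒cycle vs es (walk , start , end) unique es⊆vs 3≤len = pos , pos-injective , adjacent
    where
    pos : Fin (length es) → Fin (length vs)
    pos i = index (es⊆vs (∈-lookup i))
    lookup-pos : ∀ i → lookup es i ≡ lookup vs (pos i)
    lookup-pos i = lookup-index (es⊆vs (∈-lookup i))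
    distinct : ∀ {i j} → lookup es i ≡ lookup es j → i ≡ j
    distinct = lookup-injective unique _ _
    pos-injective : ∀ {i j} → pos i ≡ pos j → i ≡ j
    pos-injective {i} {j} eq = distinct (≡-trans (lookup-pos i) (≡-trans (cong (lookup vs) eq) (sym (lookup-pos j))))
    -- the wrap-around pair (last , first) is distinct since the walk has length ≥ 3
    adjacentInWalk : ∀ i j → suc (toℕ i) ≡ toℕ j ⊎ (suc (toℕ i) ≡ length es × toℕ j ≡ 0) →
                     AdjLine (lookup es i) (lookup es j)
    adjacentInWalk i j (inj₁ next) =
      (λ eq → ℕ.1+n≢n (≡-trans next (sym (cong toℕ (distinct eq))))) , walk-step es walk i j next
    adjacentInWalk i j (inj₂ (last , first)) =
      wrap-distinct , shareEnd-via (walk-last es end i last) (walk-first es start j first)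
      where
      wrap-distinct : lookup es i ≢ lookup es j
      wrap-distinct eq with distinct eq
      ... | refl with subst (3 ≤_) (≡-trans (sym last) (cong suc first)) 3≤len
      ... | s≤s ()
    adjacent : ∀ i j → suc (toℕ i) ≡ toℕ j ⊎ (suc (toℕ i) ≡ length es × toℕ j ≡ 0) →
               AdjLine (lookup vs (pos i)) (lookup vs (pos j))
    adjacent i j c = subst₂ AdjLine (lookup-pos i) (lookup-pos j) (adjacentInWalk i j c)

  -- Blocks: a hub walk is assembled from blocks, each either a single hub
  -- edge or a detour  a , h ∷ t , b  leaving the hub along the hub edge a,
  -- running through non-hub edges h ∷ t and returning along the hub edge b.

  data Block : Set where
    single : Edge → Block
    detour : Edge → Edge → List Edge → Edge → Block

  edgesOf : Block → List Edge
  edgesOf (single s)       = s ∷ []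
  edgesOf (detour a h t b) = a ∷ h ∷ t ++ b ∷ []

  flatten : List Block → List Edge
  flatten []       = []
  flatten (B ∷ Bs) = edgesOf B ++ flatten Bs

  ValidBlock : Block → Set
  ValidBlock (single s)       = AtHub s
  ValidBlock (detour a h t b) =
    AtHub a × AtHub b × All (λ e → ¬ AtHub e) (h ∷ t) × Walk (a ∷ h ∷ t ++ b ∷ [])

  validBlock⇒hubWalk : ∀ B → ValidBlock B → HubWalk (edgesOf B)
  validBlock⇒hubWalk (single s)       hs               = [ s ] , hs , hs
  validBlock⇒hubWalk (detour a h t b) (ha , hb , _ , w) = w , ha , endsAtHub-snoc (a ∷ h ∷ t) hb

  flatten-hubWalk : ∀ Bs → All ValidBlock Bs → HubWalk (flatten Bs)
  flatten-hubWalk []       []       = [] , tt , tt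
  flatten-hubWalk (B ∷ Bs) (v ∷ vs) =
    hubWalk-++ (edgesOf B) (validBlock⇒hubWalk B v) (flatten-hubWalk Bs vs)

  Insertion : Edge → List Block → Set
  Insertion f Bs = Σ (List Block) λ Bs' → All ValidBlock Bs' × flatten Bs' ↭ f ∷ flatten Bs

  module Insert (hub : V → Edge) (hub-spec : ∀ x → hub x ≡ (z , x) ⊎ hub x ≡ (x , z)) where

    hub-atHub : ∀ x → AtHub (hub x)
    hub-atHub x with hub-spec x
    ... | inj₁ eq = inj₁ (cong proj₁ eq)
    ... | inj₂ eq = inj₂ (cong proj₂ eq)

    hub-has : ∀ x → x ∈ₑ hub x
    hub-has x with hub-spec x
    ... | inj₁ eq = inj₂ (cong proj₂ eq)
    ... | inj₂ eq = inj₁ (cong proj₁ eq)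

    hub-ends : ∀ x {w} → w ∈ₑ hub x → w ≡ z ⊎ w ≡ x
    hub-ends x w∈ with hub-spec x
    hub-ends x (inj₁ e) | inj₁ eq = inj₁ (≡-trans (sym e) (cong proj₁ eq))
    hub-ends x (inj₂ e) | inj₁ eq = inj₂ (≡-trans (sym e) (cong proj₂ eq))
    hub-ends x (inj₁ e) | inj₂ eq = inj₂ (≡-trans (sym e) (cong proj₁ eq))
    hub-ends x (inj₂ e) | inj₂ eq = inj₁ (≡-trans (sym e) (cong proj₂ eq))

    hub-injective : ∀ {x y} → y ≢ z → hub x ≡ hub y → y ≡ x
    hub-injective {x} {y} y≢z eq with hub-ends x (subst (y ∈ₑ_) (sym eq) (hub-has y))
    ... | inj₁ y≡z = ⊥-elim (y≢z y≡z)
    ... | inj₂ y≡x = y≡x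

    next-to-hub : ∀ {x g} → ShareEnd (hub x) g → ¬ AtHub g → x ∈ₑ g
    next-to-hub {x} p g∉hub with commonEnd p
    ... | w , w∈hub , w∈g with hub-ends x w∈hub
    ... | inj₁ refl = ⊥-elim (g∉hub w∈g)
    ... | inj₂ refl = w∈g

    data Occurrence (a : Edge) (Bs : List Block) : Set where
      asSingle : (rest : List Block) → All ValidBlock rest →
                 flatten Bs ↭ a ∷ flatten rest → Occurrence a Bs
      asStart  : (h : Edge) (t : List Edge) (b : Edge) (rest : List Block) →
                 ValidBlock (detour a h t b) → All ValidBlock rest →
                 flatten Bs ↭ edgesOf (detour a h t b) ++ flatten rest → Occurrence a Bs
      asEnd    : (a' h : Edge) (t : List Edge) (rest : List Block) →
                 ValidBlock (detour a' h t a) → All ValidBlock rest →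
                 flatten Bs ↭ edgesOf (detour a' h t a) ++ flatten rest → Occurrence a Bs

    occurrence-∷ : ∀ {a} B Bs → ValidBlock B → Occurrence a Bs → Occurrence a (B ∷ Bs)
    occurrence-∷ {a} B Bs v (asSingle rest vr p) =
      asSingle (B ∷ rest) (v ∷ vr) (trans (++⁺ˡ (edgesOf B) p) (shifts (edgesOf B) (a ∷ [])))
    occurrence-∷ B Bs v (asStart h t b rest vd vr p) =
      asStart h t b (B ∷ rest) vd (v ∷ vr) (trans (++⁺ˡ (edgesOf B) p) (shifts (edgesOf B) (edgesOf (detour _ h t b))))
    occurrence-∷ B Bs v (asEnd a' h t rest vd vr p) =
      asEnd a' h t (B ∷ rest) vd (v ∷ vr) (trans (++⁺ˡ (edgesOf B) p) (shifts (edgesOf B) (edgesOf (detour a' h t _))))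

    locate : ∀ a → AtHub a → ∀ Bs → All ValidBlock Bs → a ∈ flatten Bs → Occurrence a Bs
    locate a ha (B ∷ Bs) (v ∷ vs) a∈ with ∈-++⁻ (edgesOf B) a∈
    ... | inj₂ a∈rest = occurrence-∷ B Bs v (locate a ha Bs vs a∈rest)
    locate a ha (single s ∷ Bs)       (v ∷ vs) _ | inj₁ (here refl) = asSingle Bs vs refl
    locate a ha (detour _ h t b ∷ Bs) (v ∷ vs) _ | inj₁ (here refl) = asStart h t b Bs v vs refl
    locate a ha (detour _ h t b ∷ Bs) (v@(_ , _ , nonHub , _) ∷ vs) _ | inj₁ (there a∈)
      with ∈-++⁻ (h ∷ t) a∈
    ... | inj₁ a∈inner = ⊥-elim (All.lookup nonHub a∈inner ha)
    ... | inj₂ (here refl) = asEnd _ h t Bs v vs refl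

    extendDetour : ∀ g t v f → Walk (g ∷ t ++ hub v ∷ []) → All (λ e → ¬ AtHub e) (g ∷ t) → v ∈ₑ f →
                   Walk (g ∷ (t ++ f ∷ []) ++ hub v ∷ [])
    extendDetour g []        v f (p ∷ [ _ ]) (g∉ ∷ _) v∈f =
      shareEnd-via (next-to-hub (shareEnd-sym p) g∉) v∈f ∷ (shareEnd-via v∈f (hub-has v) ∷ [ _ ])
    extendDetour g (g' ∷ t) v f (p ∷ w) (_ ∷ nonHub) v∈f = p ∷ extendDetour g' t v f w nonHub v∈f

    insertNear : ∀ {f v Bs} → v ∈ₑ f → ¬ AtHub f → Occurrence (hub v) Bs →
                 (Σ (List Block) λ rest → All ValidBlock rest × flatten Bs ↭ hub v ∷ flatten rest)
                 ⊎ Insertion f Bs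
    insertNear v∈f f∉ (asSingle rest vr p) = inj₁ (rest , vr , p)
    insertNear {f} {v} v∈f f∉ (asStart h t b rest (ha , hb , h∉ ∷ t∉ , p ∷ w) vr q) =
      inj₂ (detour (hub v) f (h ∷ t) b ∷ rest ,
            (ha , hb , f∉ ∷ h∉ ∷ t∉ ,
             shareEnd-via (hub-has v) v∈f ∷ (shareEnd-via v∈f (next-to-hub p h∉) ∷ w)) ∷ vr ,
            trans (++⁺ʳ (flatten rest) (swap (hub v) f refl)) (prep f (↭-sym q)))
    insertNear {f} {v} v∈f f∉ (asEnd a' h t rest (ha , hb , nonHub , p ∷ w) vr q) =
      inj₂ (detour a' h (t ++ f ∷ []) (hub v) ∷ rest ,
            (ha , hb , All-++⁺ nonHub (f∉ ∷ []) , p ∷ extendDetour h t v f w nonHub v∈f) ∷ vr ,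
            trans (++⁺ʳ (flatten rest) move-f) (prep f (↭-sym q)))
      where
      move-f : a' ∷ h ∷ (t ++ f ∷ []) ++ hub v ∷ [] ↭ f ∷ a' ∷ h ∷ t ++ hub v ∷ []
      move-f = subst (λ w → a' ∷ h ∷ w ↭ f ∷ a' ∷ h ∷ t ++ hub v ∷ [])
                 (sym (++-assoc t (f ∷ []) (hub v ∷ []))) (shift f (a' ∷ h ∷ t) (hub v ∷ []))

    -- Insert a non-hub edge f = (x , y) whose hub edges hub x ≠ hub y occur in
    -- the walk: next to one of them, or, if both are single blocks, as the
    -- new detour  hub x , f , hub y.
    insert : ∀ {f Bs} → ¬ AtHub f → All ValidBlock Bs →
             hub (proj₁ f) ∈ flatten Bs → hub (proj₂ f) ∈ flatten Bs →
             hub (proj₁ f) ≢ hub (proj₂ f) → Insertion f Bs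
    insert {f} {Bs} f∉ vBs x∈ y∈ hx≢hy
      with insertNear (inj₁ refl) f∉ (locate (hub (proj₁ f)) (hub-atHub _) Bs vBs x∈)
    ... | inj₂ ins = ins
    ... | inj₁ (rest , vr , p) with ∈-resp-↭ p y∈
    ... | here eq = ⊥-elim (hx≢hy (sym eq))
    ... | there y∈rest with insertNear (inj₂ refl) f∉ (locate (hub (proj₂ f)) (hub-atHub _) rest vr y∈rest)
    ... | inj₂ (Bs' , vBs' , p') =
      single (hub (proj₁ f)) ∷ Bs' , hub-atHub _ ∷ vBs' ,
      trans (prep _ p') (trans (swap _ _ refl) (prep f (↭-sym p)))
    ... | inj₁ (rest' , vr' , p') =
      detour (hub (proj₁ f)) f [] (hub (proj₂ f)) ∷ rest' ,
      (hub-atHub _ , hub-atHub _ , f∉ ∷ [] ,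
       shareEnd-via (hub-has _) (inj₁ refl) ∷ (shareEnd-via (inj₂ refl) (hub-has _) ∷ [ _ ])) ∷ vr' ,
      trans (swap _ _ refl) (prep f (trans (prep _ (↭-sym p')) (↭-sym p)))

    module Pancyclicity (vs : List Edge) (unique : Unique vs)
                        (loopless : ∀ {e} → e ∈ vs → proj₁ e ≢ proj₂ e)
                        (hub-closed : ∀ {e} → e ∈ vs → ¬ AtHub e → ∀ x → x ∈ₑ e → hub x ∈ vs) where

      hubEdges : List Edge
      hubEdges = filter atHub? vs

      otherEdges : List Edge
      otherEdges = filter (λ e → ¬? (atHub? e)) vs

      length-split : ∀ es → length es ≡ length (filter atHub? es) + length (filter (λ e → ¬? (atHub? e)) es)
      length-split []       = refl
      length-split (e ∷ es) with proj₁ e ≟ z | proj₂ e ≟ z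
      ... | yes _ | _     = cong suc (length-split es)
      ... | no  _ | yes _ = cong suc (length-split es)
      ... | no  _ | no  _ = ≡-trans (cong suc (length-split es)) (sym (ℕ.+-suc _ _))

      ∈-take : ∀ n {xs : List Edge} {e} → e ∈ take n xs → e ∈ xs
      ∈-take (suc n) {_ ∷ _} (here eq)  = here eq
      ∈-take (suc n) {_ ∷ _} (there e∈) = there (∈-take n e∈)

      hubEdges-atHub : ∀ {e} → e ∈ hubEdges → AtHub e
      hubEdges-atHub e∈ = proj₂ (∈-filter⁻ atHub? {xs = vs} e∈)

      otherEdges-inVs : ∀ {e} → e ∈ otherEdges → e ∈ vs × ¬ AtHub e
      otherEdges-inVs = ∈-filter⁻ (λ e → ¬? (atHub? e)) {xs = vs}

      singles : ∀ es → All AtHub es → Σ (List Block) λ Bs → All ValidBlock Bs × flatten Bs ≡ es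
      singles []       []        = [] , [] , refl
      singles (e ∷ es) (he ∷ hs) =
        let (Bs , vBs , eq) = singles es hs in single e ∷ Bs , he ∷ vBs , cong (e ∷_) eq

      weave : ∀ L → All (λ f → f ∈ vs × ¬ AtHub f) L →
              Σ (List Block) λ Bs → All ValidBlock Bs × flatten Bs ↭ L ++ hubEdges
      weave [] [] =
        let (Bs , vBs , eq) = singles hubEdges (All.tabulate hubEdges-atHub) in
        Bs , vBs , subst (_↭ hubEdges) (sym eq) refl
      weave (f ∷ L) ((f∈vs , f∉) ∷ inL) with weave L inL
      ... | Bs , vBs , p with insert f∉ vBs (hubIn (proj₁ f) (inj₁ refl)) (hubIn (proj₂ f) (inj₂ refl)) distinctHubs
        where
        hubIn : ∀ x → x ∈ₑ f → hub x ∈ flatten Bs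
        hubIn x x∈f = ∈-resp-↭ (↭-sym p)
          (∈-++⁺ʳ L (∈-filter⁺ atHub? {xs = vs} (hub-closed f∈vs f∉ x x∈f) (hub-atHub x)))
        distinctHubs : hub (proj₁ f) ≢ hub (proj₂ f)
        distinctHubs eq = loopless f∈vs (sym (hub-injective (λ y≡z → f∉ (inj₂ y≡z)) eq))
      ... | Bs' , vBs' , p' = Bs' , vBs' , trans p' (prep f p)

      cycleOf : ∀ {k} es → HubWalk es → Unique es → (∀ {e} → e ∈ es → e ∈ vs) → length es ≡ k → 3 ≤ k →
                HasCycle vs AdjLine k
      cycleOf es w u es⊆vs refl 3≤k = hubWalk⇒cycle vs es w u es⊆vs 3≤k

      shortCycle : ∀ k → 3 ≤ k → k ≤ length hubEdges → HasCycle vs AdjLine k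
      shortCycle k 3≤k k≤hub =
        cycleOf chosen
          (hubEdges⇒hubWalk chosen (All.tabulate (λ e∈ → hubEdges-atHub (∈-take k e∈))))
          (Unique.take⁺ k (Unique.filter⁺ atHub? unique))
          (λ e∈ → proj₁ (∈-filter⁻ atHub? {xs = vs} (∈-take k e∈)))
          (≡-trans (length-take k hubEdges) (ℕ.m≤n⇒m⊓n≡m k≤hub)) 3≤k
        where
        chosen = take k hubEdges

      longCycle : ∀ k → 3 ≤ k → k ≤ length vs → length hubEdges < k → HasCycle vs AdjLine k
      longCycle k 3≤k k≤len hub<k =
        cycleOf (flatten Bs) (flatten-hubWalk Bs vBs)
          (SetoidPerm.Unique-resp-↭ (setoid Edge) (↭⇒↭ₛ (↭-sym p)) unique-woven) woven⊆vs length-woven 3≤k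
        where
        t = k ∸ length hubEdges
        others = take t otherEdges
        t≤others : t ≤ length otherEdges
        t≤others = ℕ.m≤n+o⇒m∸n≤o k (length hubEdges) (subst (k ≤_) (length-split vs) k≤len)
        woven = weave others (All.tabulate (λ e∈ → otherEdges-inVs (∈-take t e∈)))
        Bs = proj₁ woven
        vBs = proj₁ (proj₂ woven)
        p = proj₂ (proj₂ woven)
        unique-woven : Unique (others ++ hubEdges)
        unique-woven =
          Unique.++⁺ (Unique.take⁺ t (Unique.filter⁺ _ unique)) (Unique.filter⁺ atHub? unique)
            (λ (e∈others , e∈hub) → proj₂ (otherEdges-inVs (∈-take t e∈others)) (hubEdges-atHub e∈hub))
        woven⊆vs : ∀ {e} → e ∈ flatten Bs → e ∈ vs
        woven⊆vs e∈ with ∈-++⁻ others (∈-resp-↭ p e∈)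
        ... | inj₁ e∈others = proj₁ (otherEdges-inVs (∈-take t e∈others))
        ... | inj₂ e∈hub    = proj₁ (∈-filter⁻ atHub? {xs = vs} e∈hub)
        length-woven : length (flatten Bs) ≡ k
        length-woven = ≡-trans (↭-length p) (≡-trans (length-++ others)
          (≡-trans (cong (_+ length hubEdges) (≡-trans (length-take t otherEdges) (ℕ.m≤n⇒m⊓n≡m t≤others)))
                   (ℕ.m∸n+n≡m (ℕ.<⇒≤ hub<k))))

      pancyclic : 3 ≤ length vs → Pancyclic vs AdjLine
      pancyclic 3≤len = 3≤len , λ k 3≤k k≤len → case k ≤? length hubEdges of λ where
        (yes k≤hub) → shortCycle k 3≤k k≤hub
        (no  k≰hub) → longCycle k 3≤k k≤len (ℕ.≰⇒> k≰hub)

module GaussianRing (q m : ℕ) (q-prime : Prime q) (q≡3 : q % 4 ≡ 3) (3≤m : 3 ≤ m) where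
  open import Data.Nat
  open import Data.Nat.Properties
  open import Data.Nat.Divisibility
  open import Data.Nat.DivMod using (_mod_; m<n⇒m%n≡m; m*n%n≡0; [m+kn]%n≡m%n)
  open import Data.List using (List; length; cartesianProduct)
  open import Data.List.Membership.Propositional using (_∈_)
  open import Data.List.Membership.Propositional.Properties using (∈-filter⁺; ∈-filter⁻; ∈-cartesianProduct⁺; ∈-allFin)
  open import Data.List.Relation.Unary.Unique.Propositional using (Unique)
  import Data.List.Relation.Unary.Unique.Propositional.Properties as Unique
  open import Data.Nat.Solver using (module +-*-Solver)
  open import Data.Fin using (Fin; toℕ; fromℕ<)
  open import Data.Fin.Properties using (toℕ-fromℕ<; toℕ-injective; toℕ<n)
  open import Data.Product using (_×_; _,_; proj₁; proj₂)
  open import Data.Sum using (_⊎_; inj₁; inj₂)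
  open import Data.Empty using (⊥-elim)
  open import Relation.Nullary using (¬_; yes; no)
  open import Relation.Binary.Definitions using (tri<; tri≈; tri>)
  open import Relation.Binary.PropositionalEquality
  open NumberTheory using (prime>1; prime≡3∣sumOfSquares; prime^∣-cancel)
  open +-*-Solver

  instance
    q≢0 : NonZero q
    q≢0 = prime⇒nonZero q-prime

  n : ℕ
  n = q ^ m

  instance
    n≢0 : NonZero n
    n≢0 = m^n≢0 q m

  R : Set
  R = ZnI n

  _⋆_ : R → R → R
  _⋆_ = _·_ n

  O : R
  O = 0# n

  re im : R → ℕ
  re x = toℕ (proj₁ x)
  im x = toℕ (proj₂ x)

  -- Since m ≥ 3, n exceeds q² (and so q and 2q).

  1<q : 1 < q
  1<q = prime>1 q-prime

  q*q<n : q * q < n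
  q*q<n = subst (_< n) (cong (q *_) (*-identityʳ q)) (^-monoʳ-< q 1<q {2} {m} 3≤m)

  2q<n : 2 * q < n
  2q<n = ≤-<-trans (*-monoˡ-≤ q 1<q) q*q<n

  q<n : q < n
  q<n = ≤-<-trans (m≤m*n q q) q*q<n

  0<n : 0 < n
  0<n = ≤-<-trans z≤n q<n

  -- Elements and multiplication.  re· x y and im· x y are the components
  -- of x·y before reduction modulo n, with -1 represented by n - 1.

  point : ∀ a b → a < n → b < n → R
  point a b a<n b<n = fromℕ< a<n , fromℕ< b<n

  re· im· : R → R → ℕ
  re· x y = re x * re y + (n ∸ 1) * (im x * im y)
  im· x y = re x * im y + im x * re y

  toℕ-mod : ∀ k → toℕ (k mod n) ≡ k % n
  toℕ-mod k = toℕ-fromℕ< _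

  toℕ-0 : toℕ (0 mod n) ≡ 0
  toℕ-0 = trans (toℕ-mod 0) (m*n%n≡0 0 n)

  mod≡0⇒∣ : ∀ k → k mod n ≡ 0 mod n → n ∣ k
  mod≡0⇒∣ k eq = m%n≡0⇒n∣m k n (trans (sym (toℕ-mod k)) (trans (cong toℕ eq) toℕ-0))

  ∣⇒mod≡0 : ∀ k → n ∣ k → k mod n ≡ 0 mod n
  ∣⇒mod≡0 k n∣k = toℕ-injective (trans (toℕ-mod k) (trans (n∣m⇒m%n≡0 k n n∣k) (sym toℕ-0)))

  ⋆≡O⇒ : ∀ x y → x ⋆ y ≡ O → n ∣ re· x y × n ∣ im· x y
  ⋆≡O⇒ x y eq = mod≡0⇒∣ _ (cong proj₁ eq) , mod≡0⇒∣ _ (cong proj₂ eq)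

  ⋆≡O⇐ : ∀ x y → n ∣ re· x y → n ∣ im· x y → x ⋆ y ≡ O
  ⋆≡O⇐ x y n∣re n∣im = cong₂ _,_ (∣⇒mod≡0 _ n∣re) (∣⇒mod≡0 _ n∣im)

  ⋆-comm : ∀ x y → x ⋆ y ≡ y ⋆ x
  ⋆-comm x y = cong₂ (λ u v → u mod n , v mod n)
    (cong₂ (λ u v → u + (n ∸ 1) * v) (*-comm (re x) (re y)) (*-comm (im x) (im y)))
    (trans (+-comm (re x * im y) _) (cong₂ _+_ (*-comm (im x) (re y)) (*-comm (re x) (im y))))

  ≡O : ∀ x → n ∣ re x → n ∣ im x → x ≡ O
  ≡O (a , b) n∣a n∣b = cong₂ _,_ (small a n∣a) (small b n∣b)
    where
    small : (c : Fin n) → n ∣ toℕ c → c ≡ 0 mod n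
    small c n∣c with toℕ c in eq
    ... | zero  = toℕ-injective (trans eq (sym toℕ-0))
    ... | suc k = ⊥-elim (<⇒≱ (subst (_< n) eq (toℕ<n c)) (∣⇒≤ n∣c))

  -- Multiplying x·y by the conjugate a - bi of x = a + bi gives (a² + b²)·y;
  -- with -1 written as M + 1 and n = M + 2 these are identities in ℕ.
  conj-re : ∀ M a b c d →
    a * (a * c + suc M * (b * d)) + b * (a * d + b * c) ≡ (a * a + b * b) * c + (2 + M) * (a * b * d)
  conj-re = solve 5 (λ M a b c d →
    a :* (a :* c :+ (con 1 :+ M) :* (b :* d)) :+ b :* (a :* d :+ b :* c)
      := (a :* a :+ b :* b) :* c :+ (con 2 :+ M) :* (a :* b :* d)) refl

  conj-im : ∀ M a b c d →
    a * (a * d + b * c) + suc M * b * (a * c + suc M * (b * d))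
      ≡ (a * a + b * b) * d + (2 + M) * (a * b * c + M * (b * b * d))
  conj-im = solve 5 (λ M a b c d →
    a :* (a :* d :+ b :* c) :+ (con 1 :+ M) :* b :* (a :* c :+ (con 1 :+ M) :* (b :* d))
      := (a :* a :+ b :* b) :* d :+ (con 2 :+ M) :* (a :* b :* c :+ M :* (b :* b :* d))) refl

  norm : R → ℕ
  norm x = re x * re x + im x * im x

  -- n = M + 2, so that -1 ≡ n - 1 = M + 1
  M : ℕ
  M = n ∸ 2

  n≡2+M : n ≡ 2 + M
  n≡2+M = sym (m+[n∸m]≡n (≤-trans 1<q (<⇒≤ q<n)))

  n∸1≡1+M : n ∸ 1 ≡ suc M
  n∸1≡1+M = cong (_∸ 1) n≡2+M

  norm∣ : ∀ x y → x ⋆ y ≡ O → n ∣ norm x * re y × n ∣ norm x * im y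
  norm∣ x y xy≡O = cancel (a * b * d) n∣re-combination (conj-re M a b c d) ,
                  cancel (a * b * c + M * (b * b * d)) n∣im-combination (conj-im M a b c d)
    where
    a = re x ; b = im x ; c = re y ; d = im y
    n∣re· = proj₁ (⋆≡O⇒ x y xy≡O)
    n∣im· = proj₂ (⋆≡O⇒ x y xy≡O)
    n∣re-combination : n ∣ a * (a * c + suc M * (b * d)) + b * (a * d + b * c)
    n∣re-combination = ∣m∣n⇒∣m+n (∣n⇒∣m*n a (subst (λ N → n ∣ a * c + N * (b * d)) n∸1≡1+M n∣re·))
                                 (∣n⇒∣m*n b n∣im·)
    n∣im-combination : n ∣ a * (a * d + b * c) + suc M * b * (a * c + suc M * (b * d))
    n∣im-combination = ∣m∣n⇒∣m+n (∣n⇒∣m*n a n∣im·)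
                                 (∣n⇒∣m*n (suc M * b) (subst (λ N → n ∣ a * c + N * (b * d)) n∸1≡1+M n∣re·))
    cancel : ∀ {u v} w → n ∣ u → u ≡ v + (2 + M) * w → n ∣ v
    cancel {u} {v} w n∣u eq = ∣m+n∣m⇒∣n (subst (n ∣_) (trans eq (+-comm v _)) n∣u)
                                           (subst (λ k → n ∣ k * w) n≡2+M (m∣m*n w))

  -- a zero-divisor x is a multiple of q: if q ∤ x then q ∤ norm x (as q ≡ 3 mod 4),
  -- so norm x is a unit and x·y = 0 forces y = 0
  vertex⇒q∣ : ∀ x → IsVertexΓ n x → q ∣ re x × q ∣ im x
  vertex⇒q∣ x (_ , y , y≢O , xy≡O) with q ∣? norm x
  ... | yes q∣norm = prime≡3∣sumOfSquares q-prime q≡3 (re x) (im x) q∣norm ,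
                     prime≡3∣sumOfSquares q-prime q≡3 (im x) (re x) (subst (q ∣_) (+-comm (re x * re x) _) q∣norm)
  ... | no  q∤norm = ⊥-elim (y≢O (≡O y (unit (proj₁ (norm∣ x y xy≡O))) (unit (proj₂ (norm∣ x y xy≡O)))))
    where
    unit : ∀ {c} → n ∣ norm x * c → n ∣ c
    unit = prime^∣-cancel q-prime m (norm x) _ q∤norm

  KilledByQ : R → Set
  KilledByQ x = n ∣ q * re x × n ∣ q * im x

  killed⋆multiple : ∀ v w → KilledByQ v → q ∣ re w → q ∣ im w → v ⋆ w ≡ O
  killed⋆multiple v w (n∣qa , n∣qb) (divides u c≡uq) (divides t d≡tq) = ⋆≡O⇐ v w
    (subst (n ∣_) (sym (re-eq (re v) (im v) c≡uq d≡tq)) (∣m∣n⇒∣m+n (∣n⇒∣m*n u n∣qa) (∣n⇒∣m*n ((n ∸ 1) * t) n∣qb)))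
    (subst (n ∣_) (sym (im-eq (re v) (im v) c≡uq d≡tq)) (∣m∣n⇒∣m+n (∣n⇒∣m*n t n∣qa) (∣n⇒∣m*n u n∣qb)))
    where
    N = n ∸ 1
    re-eq : ∀ a b {c d} → c ≡ u * q → d ≡ t * q → a * c + N * (b * d) ≡ u * (q * a) + N * t * (q * b)
    re-eq a b refl refl = solve 6 (λ a b u t N q →
      a :* (u :* q) :+ N :* (b :* (t :* q)) := u :* (q :* a) :+ N :* t :* (q :* b)) refl a b u t N q
    im-eq : ∀ a b {c d} → c ≡ u * q → d ≡ t * q → a * d + b * c ≡ t * (q * a) + u * (q * b)
    im-eq a b refl refl = solve 5 (λ a b u t q →
      a :* (t :* q) :+ b :* (u :* q) := t :* (q :* a) :+ u :* (q :* b)) refl a b u t q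

  -- q^(m-1) is a nonzero element killed by q
  Q : ℕ
  Q = q ^ (m ∸ 1)

  q*Q≡n : q * Q ≡ n
  q*Q≡n = cong (q ^_) (trans (+-comm 1 (m ∸ 1)) (m∸n+n≡m (≤-trans (s≤s z≤n) 3≤m)))

  Q<n : Q < n
  Q<n = subst (Q <_) (trans (*-comm Q q) q*Q≡n) (m<m*n Q q {{m^n≢0 q (m ∸ 1)}} 1<q)

  q∣⇒vertex : ∀ x → q ∣ re x → q ∣ im x → x ≢ O → IsVertexΓ n x
  q∣⇒vertex x q∣a q∣b x≢O = x≢O , w , w≢O , trans (⋆-comm x w) (killed⋆multiple w x killed q∣a q∣b)
    where
    w = point Q 0 Q<n 0<n
    w≢O : w ≢ O
    w≢O w≡O = ≢-nonZero⁻¹ Q {{m^n≢0 q (m ∸ 1)}} (trans (sym (toℕ-fromℕ< Q<n)) (trans (cong re w≡O) toℕ-0))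
    killed : KilledByQ w
    killed = subst (λ k → n ∣ q * k) (sym (toℕ-fromℕ< Q<n)) (subst (n ∣_) (sym q*Q≡n) ∣-refl) ,
             subst (λ k → n ∣ q * k) (sym (toℕ-fromℕ< 0<n)) (subst (n ∣_) (sym (*-zeroʳ q)) (n ∣0))

  z : R
  z = point q 0 q<n 0<n

  re-z : re z ≡ q
  re-z = toℕ-fromℕ< q<n

  im-z : im z ≡ 0
  im-z = toℕ-fromℕ< 0<n

  z-vertex : IsVertexΓ n z
  z-vertex = q∣⇒vertex z (subst (q ∣_) (sym re-z) ∣-refl) (subst (q ∣_) (sym im-z) (q ∣0))
                        (λ z≡O → ≢-nonZero⁻¹ q (trans (sym re-z) (trans (cong re z≡O) toℕ-0)))

  -- z·x = q·x
  z⋆≡O⇒killed : ∀ x → z ⋆ x ≡ O → KilledByQ x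
  z⋆≡O⇒killed x zx≡O with ⋆≡O⇒ z x zx≡O
  ... | n∣re , n∣im = subst (n ∣_) (re-eq (re z) (im z) re-z im-z) n∣re ,
                      subst (n ∣_) (im-eq (re z) (im z) re-z im-z) n∣im
    where
    re-eq : ∀ a b → a ≡ q → b ≡ 0 → a * re x + (n ∸ 1) * (b * im x) ≡ q * re x
    re-eq _ _ refl refl = trans (cong (q * re x +_) (*-zeroʳ (n ∸ 1))) (+-identityʳ _)
    im-eq : ∀ a b → a ≡ q → b ≡ 0 → a * im x + b * re x ≡ q * im x
    im-eq _ _ refl refl = +-identityʳ _

  z-adjacent : ∀ x → IsVertexΓ n x → x ≢ z → ¬ KilledByQ x → AdjΓc n z x
  z-adjacent x x-vertex x≢z unkilled =
    z-vertex , x-vertex , (λ z≡x → x≢z (sym z≡x)) ,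
    λ (_ , _ , _ , zx≡O) → unkilled (z⋆≡O⇒killed x zx≡O)

  AdjΓc-sym : ∀ {x y} → AdjΓc n x y → AdjΓc n y x
  AdjΓc-sym {x} {y} (vx , vy , x≢y , ¬adj) =
    vy , vx , (λ y≡x → x≢y (sym y≡x)) ,
    λ (_ , _ , _ , yx≡O) → ¬adj (vx , vy , x≢y , trans (⋆-comm x y) yx≡O)

  -- every endpoint x ≠ z of an edge of the complement is joined to z: if q
  -- killed x, then x would kill its neighbour y, a multiple of q
  joins-z : ∀ {x y} → AdjΓc n x y → x ≢ z → AdjΓc n z x
  joins-z {x} {y} (vx , vy , x≢y , ¬adj) x≢z =
    z-adjacent x vx x≢z λ killed →
      ¬adj (vx , vy , x≢y , killed⋆multiple x y killed (proj₁ (vertex⇒q∣ y vy)) (proj₂ (vertex⇒q∣ y vy)))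

  code-injective : ∀ x y → code n x ≡ code n y → x ≡ y
  code-injective (a , b) (c , d) eq = cong₂ _,_ (toℕ-injective a≡c) (toℕ-injective b≡d)
    where
    low : ∀ (a b : Fin n) → (toℕ a * n + toℕ b) % n ≡ toℕ b
    low a b = trans (cong (_% n) (+-comm (toℕ a * n) (toℕ b)))
                    (trans ([m+kn]%n≡m%n (toℕ b) (toℕ a) n) (m<n⇒m%n≡m (toℕ<n b)))
    b≡d : toℕ b ≡ toℕ d
    b≡d = trans (sym (low a b)) (trans (cong (_% n) eq) (low c d))
    a≡c : toℕ a ≡ toℕ c
    a≡c = *-cancelʳ-≡ (toℕ a) (toℕ c) n
            (+-cancelʳ-≡ (toℕ b) (toℕ a * n) (toℕ c * n) (trans eq (cong (toℕ c * n +_) (sym b≡d))))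

  orient : R → R → R × R
  orient x y with code n x <? code n y
  ... | yes _ = x , y
  ... | no  _ = y , x

  orient-spec : ∀ x y → orient x y ≡ (x , y) ⊎ orient x y ≡ (y , x)
  orient-spec x y with code n x <? code n y
  ... | yes _ = inj₁ refl
  ... | no  _ = inj₂ refl

  edges : List (R × R)
  edges = edgesΓc n

  edge∈edges : ∀ {e} → IsEdgeΓc n e → e ∈ edges
  edge∈edges = ∈-filter⁺ (isEdgeΓc? n) (∈-cartesianProduct⁺ (∈-cartesianProduct⁺ (∈-allFin _) (∈-allFin _))
                                                          (∈-cartesianProduct⁺ (∈-allFin _) (∈-allFin _)))

  ∈edges⇒edge : ∀ {e} → e ∈ edges → IsEdgeΓc n e
  ∈edges⇒edge e∈ = proj₂ (∈-filter⁻ (isEdgeΓc? n) {xs = cartesianProduct (elements n) (elements n)} e∈)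

  orient∈edges : ∀ {x y} → AdjΓc n x y → orient x y ∈ edges
  orient∈edges {x} {y} adj@(_ , _ , x≢y , _) with code n x <? code n y
  ... | yes x<y = edge∈edges (x<y , adj)
  ... | no  x≮y with <-cmp (code n x) (code n y)
  ...   | tri< x<y _ _  = ⊥-elim (x≮y x<y)
  ...   | tri≈ _ x≡y _  = ⊥-elim (x≢y (code-injective x y x≡y))
  ...   | tri> _ _ y<x  = edge∈edges (y<x , AdjΓc-sym adj)

  edges-unique : Unique edges
  edges-unique = Unique.filter⁺ (isEdgeΓc? n) (Unique.cartesianProduct⁺ elements! elements!)
    where elements! = Unique.cartesianProduct⁺ (Unique.allFin⁺ n) (Unique.allFin⁺ n)

  edges-loopless : ∀ {e} → e ∈ edges → proj₁ e ≢ proj₂ e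
  edges-loopless e∈ = proj₁ (proj₂ (proj₂ (proj₂ (∈edges⇒edge e∈))))

  open LineGraphWithHub (_≟Z_ n) z
  open Insert (orient z) (orient-spec z)

  edges-hubClosed : ∀ {e} → e ∈ edges → ¬ AtHub e → ∀ x → x ∈ₑ e → orient z x ∈ edges
  edges-hubClosed e∈ e∉hub x (inj₁ refl) =
    orient∈edges (joins-z (proj₂ (∈edges⇒edge e∈)) (λ x≡z → e∉hub (inj₁ x≡z)))
  edges-hubClosed e∈ e∉hub x (inj₂ refl) =
    orient∈edges (joins-z (AdjΓc-sym (proj₂ (∈edges⇒edge e∈))) (λ x≡z → e∉hub (inj₂ x≡z)))

  -- At least three edges: the hub edges to the spokes k·q + q·i, k ≤ 2.
  spoke : ∀ k → k ≤ 2 → R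
  spoke k k≤2 = point (k * q) q (≤-<-trans (*-monoˡ-≤ q k≤2) 2q<n) q<n

  im-spoke : ∀ k k≤2 → im (spoke k k≤2) ≡ q
  im-spoke k k≤2 = toℕ-fromℕ< q<n

  spoke≢z : ∀ k k≤2 → spoke k k≤2 ≢ z
  spoke≢z k k≤2 eq = ≢-nonZero⁻¹ q (trans (sym (im-spoke k k≤2)) (trans (cong im eq) im-z))

  spoke-injective : ∀ j k j≤2 k≤2 → spoke j j≤2 ≡ spoke k k≤2 → j ≡ k
  spoke-injective j k j≤2 k≤2 eq =
    *-cancelʳ-≡ j k q (trans (sym (toℕ-fromℕ< _)) (trans (cong re eq) (toℕ-fromℕ< _)))

  -- q·spoke has imaginary part q² ≢ 0 (mod n)
  spoke-adjacent : ∀ k k≤2 → AdjΓc n z (spoke k k≤2)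
  spoke-adjacent k k≤2 = z-adjacent x x-vertex (spoke≢z k k≤2) unkilled
    where
    x = spoke k k≤2
    x-vertex : IsVertexΓ n x
    x-vertex = q∣⇒vertex x (subst (q ∣_) (sym (toℕ-fromℕ< _)) (n∣m*n k))
                           (subst (q ∣_) (sym (im-spoke k k≤2)) ∣-refl)
                           (λ x≡O → ≢-nonZero⁻¹ q (trans (sym (im-spoke k k≤2)) (trans (cong im x≡O) toℕ-0)))
    unkilled : ¬ KilledByQ x
    unkilled (_ , n∣q*im) =
      >⇒∤ {{m*n≢0 q q}} q*q<n (subst (λ k → n ∣ q * k) (im-spoke k k≤2) n∣q*im)

  three-edges : 3 ≤ length edges
  three-edges = length≥3 (member 0 0≤2) (member 1 1≤2) (member 2 2≤2)
                         (distinct 0 1 0≤2 1≤2 (λ ())) (distinct 0 2 0≤2 2≤2 (λ ())) (distinct 1 2 1≤2 2≤2 (λ ()))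
    where
    0≤2 : 0 ≤ 2
    0≤2 = z≤n
    1≤2 : 1 ≤ 2
    1≤2 = s≤s z≤n
    2≤2 : 2 ≤ 2
    2≤2 = ≤-refl
    member : ∀ k k≤2 → orient z (spoke k k≤2) ∈ edges
    member k k≤2 = orient∈edges (spoke-adjacent k k≤2)
    distinct : ∀ j k j≤2 k≤2 → j ≢ k → orient z (spoke j j≤2) ≢ orient z (spoke k k≤2)
    distinct j k j≤2 k≤2 j≢k eq =
      j≢k (sym (spoke-injective k j k≤2 j≤2 (hub-injective (spoke≢z k k≤2) eq)))

  lineGraph-pancyclic : LineComplΓPancyclic n
  lineGraph-pancyclic =
    Pancyclicity.pancyclic edges edges-unique edges-loopless edges-hubClosed three-edges

theorem5p2 : (q m : ℕ) (qPrime : Prime q) → q % 4 ≡ 3 → 3 ≤ m →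
    LineComplΓPancyclic (q ^ m) {{m^n≢0 q m {{prime⇒nonZero qPrime}}}}
theorem5p2 q m qPrime q≡3 3≤m = GaussianRing.lineGraph-pancyclic q m qPrime q≡3 3≤m
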